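{- Let $N$ be a Minsky machine and $k\ge1$. Then $N$ terminates if and only if $[\![N]\!]_1\Downarrow^k_e$.
   Context: Minsky machines: two registers $r_0,r_1$ holding natural numbers, and instructions $(1:I_1),\dots,(n:I_n)$, each of the form $\mathtt{INC}(r_j)$ (add 1 to $r_j$, go to the next instruction), $\mathtt{DECJ}(r_j,s)$ (if $r_j=0$ jump to instruction $s$, otherwise subtract 1 from $r_j$ and go to the next instruction) or $\mathtt{HALT}$; all referenced labels exist. A configuration is $(i,m_0,m_1)$ (program counter and register values); the machine starts in $(1,0,0)$ and terminates if its (deterministic) computation reaches a configuration whose program counter labels a $\mathtt{HALT}$ instruction. Calculus. Names from a countable set $\mathcal N$; prefixes $\pi ::= a \mid \overline{a} \mid \widetilde{a}\{U\}$; processes $P ::= a[P] \mid P\parallel P \mid \sum_{i\in I}\pi_i.P_i \mid\ !\pi.P$ ($\mathbf 0$ the empty sum; $\pi$ abbreviates $\pi.\mathbf 0$); update patterns $U$ are terms with holes $\bullet$, and $U\{Q\}$ replaces the holes of $U$ (not inside update prefixes) by $Q$. Semantics: $a[P]\xrightarrow{a[P]}\star$ ($\star$ placeholder); $\sum_{i\in I}\pi_i.P_i\xrightarrow{\pi_j}P_j$; $!\pi.P\xrightarrow{\pi}P\parallel!\pi.P$; labels propagate through $a[\cdot]$ and either side of $\parallel$; $a$ and $\overline a$ in parallel components synchronise to $\tau$; if $P_1\xrightarrow{a[Q]}P_1'$ and $P_2\xrightarrow{\widetilde a\{U\}}P_2'$ then $P_1\parallel P_2\xrightarrow\tau P_1'[U\{Q\}/\star]\parallel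 P_2'$ (and symmetrically). (For the processes below, which have no nested locations, this coincides with the static semantics of $\mathcal E_s^1$.) $P\to P'$ means $P\xrightarrow\tau P'$. For $\alpha\in\{a,\overline a\}$, $P\downarrow_\alpha$ iff $P\xrightarrow\alpha P'$ for some $P'$; $P\Downarrow^k_\alpha$ iff there exist $Q_1,\dots,Q_k$ with $P\to^*Q_1\to Q_2\to\cdots\to Q_k$ and $Q_i\downarrow_\alpha$ for all $i$. Encoding (using pairwise distinct names $p_i$, $u_j$, $z_j$, $r_j$, $e$): $\langle 0\rangle_j=\overline{z_j}$, $\langle n\rangle_j=\overline{u_j}.\langle n-1\rangle_j$ for $n>0$; register $[\![r_j=n]\!]_1=r_j[\langle n\rangle_j]$; $[\![(i:\mathtt{INC}(r_j))]\!]_1=!p_i.\widetilde{r_j}\{r_j[\overline{u_j}.\bullet]\}.\overline{p_{i+1}}$; $[\![(i:\mathtt{DECJ}(r_j,s))]\!]_1=!p_i.(u_j.\overline{p_{i+1}}+z_j.\widetilde{r_j}\{r_j[\overline{z_j}]\}.\overline{p_s})$; $[\![(i:\mathtt{HALT})]\!]_1=!p_i.(e+\overline{p_i})$. For $N$ with instructions $(1:I_1),\dots,(n:I_n)$: $[\![N]\!]_1=[\![r_0=0]\!]_1\parallel[\![r_1=0]\!]_1\parallel\prod_{i=1}^n[\![(i:I_i)]\!]_1\parallel\overline{p_1}$. -}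

module Defs where

open import Data.Nat using (ℕ; zero; suc; _+_; _≤_)
open import Data.Fin using (Fin)
open import Data.Unit using (⊤)
import Data.Fin as F
open import Data.List using (List; []; _∷_; length)
open import Data.Maybe using (Maybe; just; nothing)
open import Data.Product using (_×_; _,_; ∃; ∃-syntax)
open import Relation.Binary.PropositionalEquality using (_≡_)
open import Data.List.Membership.Propositional using (_∈_)
open import Relation.Binary.Construct.Closure.ReflexiveTransitive using (Star)

-- Minsky machines (labels are 1-indexed natural numbers)

data Instr : Set where
  INC  : Fin 2 → Instr
  DECJ : Fin 2 → ℕ → Instr
  HALT : Instr

Program : Set
Program = List Instr

-- instruction with label i (label 0 and labels > n do not exist)
instrAt : Program → ℕ → Maybe Instr
instrAt []       _             = nothing
instrAt (I ∷ Is) zero          = nothing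
instrAt (I ∷ Is) (suc zero)    = just I
instrAt (I ∷ Is) (suc (suc i)) = instrAt Is (suc i)

LabelExists : Program → ℕ → Set
LabelExists N i = (1 ≤ i) × (i ≤ length N)

RefsOK : Program → ℕ → Instr → Set
RefsOK N i (INC j)    = LabelExists N (suc i)
RefsOK N i (DECJ j s) = LabelExists N (suc i) × LabelExists N s
RefsOK N i HALT       = ⊤

WellFormed : Program → Set
WellFormed N = ∀ i I → instrAt N i ≡ just I → RefsOK N i I

Config : Set
Config = ℕ × ℕ × ℕ

reg : Fin 2 → Config → ℕ
reg F.zero       (i , m₀ , m₁) = m₀
reg (F.suc F.zero) (i , m₀ , m₁) = m₁

setReg : Fin 2 → ℕ → ℕ → Config → Config
setReg F.zero         pc v (i , m₀ , m₁) = (pc , v , m₁)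
setReg (F.suc F.zero) pc v (i , m₀ , m₁) = (pc , m₀ , v)

pcOf : Config → ℕ
pcOf (i , _ , _) = i

data Step (N : Program) : Config → Config → Set where
  inc   : ∀ {c j} → instrAt N (pcOf c) ≡ just (INC j) →
          Step N c (setReg j (suc (pcOf c)) (suc (reg j c)) c)
  decZ  : ∀ {c j s} → instrAt N (pcOf c) ≡ just (DECJ j s) → reg j c ≡ 0 →
          Step N c (setReg j s 0 c)
  decS  : ∀ {c j s m} → instrAt N (pcOf c) ≡ just (DECJ j s) → reg j c ≡ suc m →
          Step N c (setReg j (suc (pcOf c)) m c)

Terminates : Program → Set
Terminates N = ∃[ c ] (Star (Step N) (1 , 0 , 0) c × instrAt N (pcOf c) ≡ just HALT)

Name : Set
Name = ℕ

mutual
  data Prefix : Set where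
    inp : Name → Prefix
    out : Name → Prefix
    upd : Name → Term → Prefix

  -- processes, update patterns (with holes •) and derivatives (with ⋆)
  data Term : Set where
    loc  : Name → Term → Term
    par  : Term → Term → Term
    sum  : List (Prefix × Term) → Term
    rep  : Prefix → Term → Term
    hole : Term
    star : Term

nil : Term
nil = sum []

pre : Prefix → Term → Term
pre π P = sum ((π , P) ∷ [])

-- U{Q}: replace holes (not inside update prefixes) by Q
mutual
  fill : Term → Term → Term
  fill (loc a P)  Q = loc a (fill P Q)
  fill (par P R)  Q = par (fill P Q) (fill R Q)
  fill (sum L)    Q = sum (fillL L Q)
  fill (rep π P)  Q = rep π (fill P Q)
  fill hole       Q = Q
  fill star       Q = star

  fillL : List (Prefix × Term) → Term → List (Prefix × Term)
  fillL []             Q = []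
  fillL ((π , P) ∷ L)  Q = (π , fill P Q) ∷ fillL L Q

mutual
  substStar : Term → Term → Term
  substStar (loc a P)  R = loc a (substStar P R)
  substStar (par P S)  R = par (substStar P R) (substStar S R)
  substStar (sum L)    R = sum (substStarL L R)
  substStar (rep π P)  R = rep π (substStar P R)
  substStar hole       R = hole
  substStar star       R = R

  substStarL : List (Prefix × Term) → Term → List (Prefix × Term)
  substStarL []            R = []
  substStarL ((π , P) ∷ L) R = (π , substStar P R) ∷ substStarL L R

data Label : Set where
  τ   : Label
  act : Prefix → Label
  lc  : Name → Term → Label

infix 4 _—[_]→_
data _—[_]→_ : Term → Label → Term → Set where
  locOut : ∀ {a P} → loc a P —[ lc a P ]→ star
  sumAct : ∀ {L π P} → (π , P) ∈ L → sum L —[ act π ]→ P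
  repAct : ∀ {π P} → rep π P —[ act π ]→ par P (rep π P)
  locPr  : ∀ {a P P' ℓ} → P —[ ℓ ]→ P' → loc a P —[ ℓ ]→ loc a P'
  parL   : ∀ {P P' Q ℓ} → P —[ ℓ ]→ P' → par P Q —[ ℓ ]→ par P' Q
  parR   : ∀ {P Q Q' ℓ} → Q —[ ℓ ]→ Q' → par P Q —[ ℓ ]→ par P Q'
  syncL  : ∀ {a P P' Q Q'} → P —[ act (inp a) ]→ P' → Q —[ act (out a) ]→ Q' →
           par P Q —[ τ ]→ par P' Q'
  syncR  : ∀ {a P P' Q Q'} → P —[ act (out a) ]→ P' → Q —[ act (inp a) ]→ Q' →
           par P Q —[ τ ]→ par P' Q'
  updL   : ∀ {a R U P P' Q Q'} → P —[ lc a R ]→ P' → Q —[ act (upd a U) ]→ Q' →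
           par P Q —[ τ ]→ par (substStar P' (fill U R)) Q'
  updR   : ∀ {a R U P P' Q Q'} → P —[ act (upd a U) ]→ P' → Q —[ lc a R ]→ Q' →
           par P Q —[ τ ]→ par P' (substStar Q' (fill U R))

_⟶_ : Term → Term → Set
P ⟶ P' = P —[ τ ]→ P'

_⟶*_ : Term → Term → Set
_⟶*_ = Star _⟶_

Barb : Term → Prefix → Set
Barb P α = ∃[ P' ] (P —[ act α ]→ P')

data Run (α : Prefix) : ℕ → Term → Set where
  one  : ∀ {Q} → Barb Q α → Run α 1 Q
  more : ∀ {k Q Q'} → Barb Q α → Q ⟶ Q' → Run α (suc k) Q' → Run α (suc (suc k)) Q

WeakBarb : ℕ → Prefix → Term → Set
WeakBarb k α P = ∃[ Q ] (P ⟶* Q × Run α k Q)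

-- The encoding; pairwise distinct names:
--   e = 0, r_j = 1 + j, u_j = 3 + j, z_j = 5 + j, p_i = 7 + i

nE : Name
nE = 0

nR nU nZ : Fin 2 → Name
nR j = 1 + F.toℕ j
nU j = 3 + F.toℕ j
nZ j = 5 + F.toℕ j

nP : ℕ → Name
nP i = 7 + i

numeral : Fin 2 → ℕ → Term
numeral j zero    = pre (out (nZ j)) nil
numeral j (suc n) = pre (out (nU j)) (numeral j n)

encReg : Fin 2 → ℕ → Term
encReg j n = loc (nR j) (numeral j n)

encInstr : ℕ → Instr → Term
encInstr i (INC j) =
  rep (inp (nP i))
      (pre (upd (nR j) (loc (nR j) (pre (out (nU j)) hole)))
           (pre (out (nP (suc i))) nil))
encInstr i (DECJ j s) =
  rep (inp (nP i))
      (sum ( (inp (nU j) , pre (out (nP (suc i))) nil)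
           ∷ (inp (nZ j) , pre (upd (nR j) (loc (nR j) (pre (out (nZ j)) nil)))
                               (pre (out (nP s)) nil))
           ∷ []))
encInstr i HALT =
  rep (inp (nP i)) (sum ((inp nE , nil) ∷ (out (nP i) , nil) ∷ []))

encInstrs : ℕ → List Instr → Term
encInstrs i []       = nil
encInstrs i (I ∷ Is) = par (encInstr i I) (encInstrs (suc i) Is)

encode : Program → Term
encode N = par (encReg F.zero 0)
               (par (encReg (F.suc F.zero) 0)
                    (par (encInstrs 1 N) (pre (out (nP 1)) nil)))

module Submission where

-- The encoded system is  r₀[..] ∥ r₁[..] ∥ X : two register locations and a
-- program part X in which exactly one "token" is active, all other components
-- being passive (dead or replicated instruction encodings !p_i.body_i).  The
-- token is a jump p̄_i, a spawned instruction body, or the residue of a DECJ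
-- after a successful zero test.
-- Backward: the invariant `Good` (a reachable configuration, a passive context
-- and a token in phase with the registers) is preserved by reduction, and an
-- e-barb of a good term exposes a HALT instruction at a reachable configuration.
-- Forward: every machine step is matched by a few reductions (`simulate`); at a
-- HALT the body offers e and can re-spawn itself forever, giving k e-barbs.

open import Defs
open import Data.Nat using (ℕ; zero; suc; _+_; _≤_; s≤s; z≤n)
open import Data.Nat.Properties using (+-cancelˡ-≡; +-identityʳ; +-suc)
import Data.Fin as F
open import Data.Fin using (Fin)
open import Data.Fin.Properties using (toℕ-injective)
open import Data.List using ([]; _∷_)
open import Data.List.Relation.Unary.Any using (here; there)
open import Data.Maybe using (just)
open import Data.Product using (Σ; _×_; _,_; proj₁)
open import Data.Unit using (⊤; tt)
open import Data.Empty using (⊥-elim)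
open import Relation.Nullary using (¬_)
open import Relation.Binary.PropositionalEquality using (_≡_; _≢_; refl; sym; subst; subst₂)
open import Relation.Binary.Construct.Closure.ReflexiveTransitive using (Star; ε; _◅_; _◅◅_)
open import Function.Bundles using (_⇔_; mk⇔)

pattern R₀ = F.zero
pattern R₁ = F.suc F.zero

-- Names.  Each family of names adds a fixed offset to the register index, so
-- names of one family determine the register, and families are disjoint.

offset-injective : ∀ k {j j' : Fin 2} → k + F.toℕ j ≡ k + F.toℕ j' → j ≡ j'
offset-injective k e = toℕ-injective (+-cancelˡ-≡ k _ _ e)

nR-injective : ∀ {j j'} → nR j ≡ nR j' → j ≡ j'
nR-injective = offset-injective 1

nU-injective : ∀ {j j'} → nU j ≡ nU j' → j ≡ j'
nU-injective = offset-injective 3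

nZ-injective : ∀ {j j'} → nZ j ≡ nZ j' → j ≡ j'
nZ-injective = offset-injective 5

nU≢nZ : ∀ j j' → nU j ≢ nZ j'
nU≢nZ R₀ _ ()
nU≢nZ R₁ _ ()

nP≢nU : ∀ i j → nP i ≢ nU j
nP≢nU _ R₀ ()
nP≢nU _ R₁ ()

nP≢nZ : ∀ i j → nP i ≢ nZ j
nP≢nZ _ R₀ ()
nP≢nZ _ R₁ ()

step-≡ : ∀ {A B ℓ A'} → A ≡ B → A —[ ℓ ]→ A' → B —[ ℓ ]→ A'
step-≡ refl d = d

summand₁ : ∀ {π P L} → sum ((π , P) ∷ L) —[ act π ]→ P
summand₁ = sumAct (here refl)

summand₂ : ∀ {π P π' P' L} → sum ((π' , P') ∷ (π , P) ∷ L) —[ act π ]→ P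
summand₂ = sumAct (there (here refl))

sum-noLoc : ∀ {L a Q P'} → ¬ (sum L —[ lc a Q ]→ P')
sum-noLoc ()

numeral-noLoc : ∀ j m {a Q P'} → ¬ (numeral j m —[ lc a Q ]→ P')
numeral-noLoc j zero    = sum-noLoc
numeral-noLoc j (suc m) = sum-noLoc

location-taken : ∀ {n P a Q A'} → (∀ {b S P'} → ¬ (P —[ lc b S ]→ P')) →
                 loc n P —[ lc a Q ]→ A' → a ≡ n × Q ≡ P × A' ≡ star
location-taken noLoc locOut    = refl , refl , refl
location-taken noLoc (locPr d) = ⊥-elim (noLoc d)

data Ctx : Set where
  □     : Ctx
  left  : Ctx → Term → Ctx
  right : Term → Ctx → Ctx

plug : Ctx → Term → Term
plug □           x = x
plug (left C P)  x = par (plug C x) P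
plug (right P C) x = par P (plug C x)

plug-step : ∀ C {x x' ℓ} → x —[ ℓ ]→ x' → plug C x —[ ℓ ]→ plug C x'
plug-step □           d = d
plug-step (left C P)  d = parL (plug-step C d)
plug-step (right P C) d = parR (plug-step C d)

-- The pieces of the encoding: a jump p̄_i, the body spawned by !p_i, the
-- update pattern of INC, the empty register left by a zero test, and the
-- residue of DECJ after the zero test.  They agree definitionally with the
-- encoding of Defs; in particular encInstr i I reduces to !p_i.(body i I).

goto : ℕ → Term
goto i = pre (out (nP i)) nil

incPattern : Fin 2 → Term
incPattern j = loc (nR j) (pre (out (nU j)) hole)

emptyReg : Fin 2 → Term
emptyReg j = loc (nR j) nil

restore : Fin 2 → ℕ → Term
restore j s = pre (upd (nR j) (encReg j 0)) (goto s)

body : ℕ → Instr → Term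
body i (INC j)    = pre (upd (nR j) (incPattern j)) (goto (suc i))
body i (DECJ j s) = sum ((inp (nU j) , goto (suc i)) ∷ (inp (nZ j) , restore j s) ∷ [])
body i HALT       = sum ((inp nE , nil) ∷ (out (nP i) , nil) ∷ [])

Regs : Set
Regs = Term × Term

sys : Regs → Term → Term
sys (A₀ , A₁) X = par A₀ (par A₁ X)

_at_ : Regs → Fin 2 → Term
(A₀ , A₁) at R₀ = A₀
(A₀ , A₁) at R₁ = A₁

_[_≔_] : Regs → Fin 2 → Term → Regs
(A₀ , A₁) [ R₀ ≔ A ] = (A , A₁)
(A₀ , A₁) [ R₁ ≔ A ] = (A₀ , A)

at-set : ∀ R j A → (R [ j ≔ A ]) at j ≡ A
at-set R R₀ A = refl
at-set R R₁ A = refl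

set-set : ∀ R j A B → (R [ j ≔ A ]) [ j ≔ B ] ≡ R [ j ≔ B ]
set-set R R₀ A B = refl
set-set R R₁ A B = refl

encRegs : Config → Regs
encRegs (i , m₀ , m₁) = (encReg R₀ m₀ , encReg R₁ m₁)

encRegs-at : ∀ j c → encRegs c at j ≡ encReg j (reg j c)
encRegs-at R₀ (i , m₀ , m₁) = refl
encRegs-at R₁ (i , m₀ , m₁) = refl

encRegs-setReg : ∀ j pc v c → encRegs (setReg j pc v c) ≡ encRegs c [ j ≔ encReg j v ]
encRegs-setReg R₀ pc v (i , m₀ , m₁) = refl
encRegs-setReg R₁ pc v (i , m₀ , m₁) = refl

pcOf-setReg : ∀ j pc v c → pcOf (setReg j pc v c) ≡ pc
pcOf-setReg R₀ pc v (i , m₀ , m₁) = refl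
pcOf-setReg R₁ pc v (i , m₀ , m₁) = refl

register-at : ∀ j c {ℓ A'} → encReg j (reg j c) —[ ℓ ]→ A' → encRegs c at j —[ ℓ ]→ A'
register-at j c = step-≡ (sym (encRegs-at j c))

decrement-at : ∀ j c {m} → reg j c ≡ suc m → encRegs c at j —[ act (out (nU j)) ]→ encReg j m
decrement-at j c {m} e =
  register-at j c (subst (λ v → encReg j v —[ act (out (nU j)) ]→ encReg j m) (sym e)
                         (locPr summand₁))

zero-at : ∀ j c → reg j c ≡ 0 → encRegs c at j —[ act (out (nZ j)) ]→ emptyReg j
zero-at j c e =
  register-at j c (subst (λ v → encReg j v —[ act (out (nZ j)) ]→ emptyReg j) (sym e)
                         (locPr summand₁))

data RegisterOutput (j : Fin 2) (m : ℕ) (a : Name) (A' : Term) : Set where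
  decrement : ∀ {m'} → a ≡ nU j → m ≡ suc m' → A' ≡ encReg j m' → RegisterOutput j m a A'
  zeroTest  : a ≡ nZ j → m ≡ 0 → A' ≡ emptyReg j → RegisterOutput j m a A'

register-output : ∀ j m {a A'} → encReg j m —[ act (out a) ]→ A' → RegisterOutput j m a A'
register-output j zero    (locPr (sumAct (here refl))) = zeroTest refl refl refl
register-output j zero    (locPr (sumAct (there ())))
register-output j (suc m) (locPr (sumAct (here refl))) = decrement refl refl refl
register-output j (suc m) (locPr (sumAct (there ())))

data Register (k : Fin 2) : Term → Set where
  holds : ∀ m → Register k (encReg k m)
  empty : Register k (emptyReg k)

encRegs-registers : ∀ c k → Register k (encRegs c at k)
encRegs-registers (i , m₀ , m₁) R₀ = holds m₀
encRegs-registers (i , m₀ , m₁) R₁ = holds m₁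

emptied-registers : ∀ j c k → Register k ((encRegs c [ j ≔ emptyReg j ]) at k)
emptied-registers R₀ (i , m₀ , m₁) R₀ = empty
emptied-registers R₀ (i , m₀ , m₁) R₁ = holds m₁
emptied-registers R₁ (i , m₀ , m₁) R₀ = holds m₀
emptied-registers R₁ (i , m₀ , m₁) R₁ = empty

data RegisterLabel : Label → Set where
  output   : ∀ {a} → RegisterLabel (act (out a))
  location : ∀ {a Q} → RegisterLabel (lc a Q)

register-label : ∀ {k A ℓ A'} → Register k A → A —[ ℓ ]→ A' → RegisterLabel ℓ
register-label (holds m)       locOut                       = location
register-label (holds zero)    (locPr (sumAct (here refl))) = output
register-label (holds zero)    (locPr (sumAct (there ())))
register-label (holds (suc m)) (locPr (sumAct (here refl))) = output
register-label (holds (suc m)) (locPr (sumAct (there ())))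
register-label empty           locOut                       = location
register-label empty           (locPr (sumAct ()))

register-no-jump : ∀ {k A i A'} → Register k A → ¬ (A —[ act (out (nP i)) ]→ A')
register-no-jump (holds m) d with register-output _ m d
... | decrement e _ _ = nP≢nU _ _ e
... | zeroTest e _ _  = nP≢nZ _ _ e
register-no-jump empty (locPr (sumAct ()))

register-name : ∀ {k A a Q A'} → Register k A → A —[ lc a Q ]→ A' → a ≡ nR k
register-name (holds m) d = proj₁ (location-taken (numeral-noLoc _ m) d)
register-name empty     d = proj₁ (location-taken sum-noLoc d)

data SysStep (R : Regs) (X : Term) : Label → Term → Set where
  inner  : ∀ {ℓ X'} → X —[ ℓ ]→ X' → SysStep R X ℓ (sys R X')
  comm   : ∀ j {a A' X'} → R at j —[ act (out a) ]→ A' → X —[ act (inp a) ]→ X' →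
           SysStep R X τ (sys (R [ j ≔ A' ]) X')
  update : ∀ j {a Q U A' X'} → R at j —[ lc a Q ]→ A' → X —[ act (upd a U) ]→ X' →
           SysStep R X τ (sys (R [ j ≔ substStar A' (fill U Q) ]) X')

sys-step : ∀ {R X ℓ T} → SysStep R X ℓ T → sys R X —[ ℓ ]→ T
sys-step (inner d)          = parR (parR d)
sys-step (comm R₀ dA dX)    = syncR dA (parR dX)
sys-step (comm R₁ dA dX)    = parR (syncR dA dX)
sys-step (update R₀ dA dX)  = updL dA (parR dX)
sys-step (update R₁ dA dX)  = parR (updL dA dX)

sys-inv : ∀ {R X ℓ T} → (∀ k → Register k (R at k)) → ¬ RegisterLabel ℓ →
          sys R X —[ ℓ ]→ T → SysStep R X ℓ T
sys-inv regs notReg (parL d) = ⊥-elim (notReg (register-label (regs R₀) d))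
sys-inv regs notReg (parR (parL d)) = ⊥-elim (notReg (register-label (regs R₁) d))
sys-inv regs notReg (parR (parR d)) = inner d
sys-inv regs notReg (parR (syncL d₁ d₂)) with register-label (regs R₁) d₁
... | ()
sys-inv regs notReg (parR (syncR d₁ d₂)) = comm R₁ d₁ d₂
sys-inv regs notReg (parR (updL d₁ d₂)) = update R₁ d₁ d₂
sys-inv regs notReg (parR (updR d₁ d₂)) with register-label (regs R₁) d₁
... | ()
sys-inv regs notReg (syncL d₁ d₂) with register-label (regs R₀) d₁
... | ()
sys-inv regs notReg (syncR d₁ (parL d₂)) with register-label (regs R₁) d₂
... | ()
sys-inv regs notReg (syncR d₁ (parR d₂)) = comm R₀ d₁ d₂
sys-inv regs notReg (updL d₁ (parL d₂)) with register-label (regs R₁) d₂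
... | ()
sys-inv regs notReg (updL d₁ (parR d₂)) = update R₀ d₁ d₂
sys-inv regs notReg (updR d₁ d₂) with register-label (regs R₀) d₁
... | ()

data Token : Set where
  jump  : ℕ → Token
  exec  : ℕ → Instr → Token
  reset : Fin 2 → ℕ → Token

⟦_⟧ : Token → Term
⟦ jump i ⟧   = goto i
⟦ exec i I ⟧ = body i I
⟦ reset j s ⟧ = restore j s

data Move : Token → Label → Term → Set where
  jumpOut  : ∀ {i} → Move (jump i) (act (out (nP i))) nil
  incUpd   : ∀ {i j} → Move (exec i (INC j)) (act (upd (nR j) (incPattern j))) ⟦ jump (suc i) ⟧
  decPos   : ∀ {i j s} → Move (exec i (DECJ j s)) (act (inp (nU j))) ⟦ jump (suc i) ⟧
  decZero  : ∀ {i j s} → Move (exec i (DECJ j s)) (act (inp (nZ j))) ⟦ reset j s ⟧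
  haltBarb : ∀ {i} → Move (exec i HALT) (act (inp nE)) nil
  haltLoop : ∀ {i} → Move (exec i HALT) (act (out (nP i))) nil
  resetUpd : ∀ {j s} → Move (reset j s) (act (upd (nR j) (encReg j 0))) ⟦ jump s ⟧

move : ∀ t {ℓ x'} → ⟦ t ⟧ —[ ℓ ]→ x' → Move t ℓ x'
move (jump i)          (sumAct (here refl))        = jumpOut
move (jump i)          (sumAct (there ()))
move (exec i (INC j))  (sumAct (here refl))        = incUpd
move (exec i (INC j))  (sumAct (there ()))
move (exec i (DECJ j s)) (sumAct (here refl))        = decPos
move (exec i (DECJ j s)) (sumAct (there (here refl))) = decZero
move (exec i (DECJ j s)) (sumAct (there (there ())))
move (exec i HALT)     (sumAct (here refl))        = haltBarb
move (exec i HALT)     (sumAct (there (here refl))) = haltLoop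
move (exec i HALT)     (sumAct (there (there ())))
move (reset j s)       (sumAct (here refl))        = resetUpd
move (reset j s)       (sumAct (there ()))

token-noLoc : ∀ t {a Q x'} → ¬ (⟦ t ⟧ —[ lc a Q ]→ x')
token-noLoc t d with move t d
... | ()

data Contains (i : ℕ) (I : Instr) : Term → Set where
  replica : Contains i I (rep (inp (nP i)) (body i I))
  parˡ    : ∀ {P Q} → Contains i I P → Contains i I (par P Q)
  parʳ    : ∀ {P Q} → Contains i I Q → Contains i I (par P Q)

data CtxContains (i : ℕ) (I : Instr) : Ctx → Set where
  viaL : ∀ {C P} → CtxContains i I C → CtxContains i I (left C P)
  atL  : ∀ {C P} → Contains i I P → CtxContains i I (left C P)
  viaR : ∀ {P C} → CtxContains i I C → CtxContains i I (right P C)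
  atR  : ∀ {P C} → Contains i I P → CtxContains i I (right P C)

plug-contains : ∀ {i I C x} → CtxContains i I C → Contains i I (plug C x)
plug-contains (viaL c) = parˡ (plug-contains c)
plug-contains (atL c)  = parʳ c
plug-contains (viaR c) = parʳ (plug-contains c)
plug-contains (atR c)  = parˡ c

Preserves : Ctx → Ctx → Set
Preserves C C' = ∀ {i I} → CtxContains i I C → CtxContains i I C'

spawn-body : ∀ {i I P} → Contains i I P →
             Σ Ctx λ C → (P —[ act (inp (nP i)) ]→ plug C (body i I)) ×
                         (∀ {i' I'} → Contains i' I' P → CtxContains i' I' C)
spawn-body replica = left □ _ , repAct , atL
spawn-body (parˡ {Q = Q} c) with spawn-body c
... | C , d , keep = left C Q , parL d , λ { (parˡ c') → viaL (keep c') ; (parʳ c') → atL c' }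
spawn-body (parʳ {P = P} c) with spawn-body c
... | C , d , keep = right P C , parR d , λ { (parˡ c') → atR c' ; (parʳ c') → viaR (keep c') }

call : ∀ C {x x' i I} → x —[ act (out (nP i)) ]→ x' → CtxContains i I C →
       Σ Ctx λ C' → (plug C x ⟶ plug C' (body i I)) × Preserves C C'
call (left C P) dx (viaL c) with call C dx c
... | C' , d , keep = left C' P , parL d , λ { (viaL c') → viaL (keep c') ; (atL c') → atL c' }
call (left C P) {x' = x'} dx (atL c) with spawn-body c
... | C' , d , keep = right (plug C x') C' , syncR (plug-step C dx) d ,
                      λ { (viaL c') → atR (plug-contains c') ; (atL c') → viaR (keep c') }
call (right P C) dx (viaR c) with call C dx c
... | C' , d , keep = right P C' , parR d , λ { (viaR c') → viaR (keep c') ; (atR c') → atR c' }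
call (right P C) {x' = x'} dx (atR c) with spawn-body c
... | C' , d , keep = left C' (plug C x') , syncL d (plug-step C dx) ,
                      λ { (viaR c') → atL (plug-contains c') ; (atR c') → viaL (keep c') }

contains-instr : ∀ i I → Contains i I (encInstr i I)
contains-instr i (INC j)    = replica
contains-instr i (DECJ j s) = replica
contains-instr i HALT       = replica

contains-instrs : ∀ k Is {m I} → instrAt Is (suc m) ≡ just I →
                  Contains (k + m) I (encInstrs k Is)
contains-instrs k (I ∷ Is) {zero} refl =
  parˡ (subst (λ i → Contains i I (encInstr k I)) (sym (+-identityʳ k)) (contains-instr k I))
contains-instrs k (I₀ ∷ Is) {suc m} {I} e =
  parʳ (subst (λ i → Contains i I (encInstrs (suc k) Is)) (sym (+-suc k m))
              (contains-instrs (suc k) Is e))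

module Simulation (N : Program) where

  Reachable : Config → Set
  Reachable = Star (Step N) (1 , 0 , 0)

  data Passive : Term → Set where
    dead        : Passive nil
    instruction : ∀ {i I} → instrAt N i ≡ just I → Passive (rep (inp (nP i)) (body i I))
    both        : ∀ {P Q} → Passive P → Passive Q → Passive (par P Q)

  PassiveCtx : Ctx → Set
  PassiveCtx □           = ⊤
  PassiveCtx (left C P)  = PassiveCtx C × Passive P
  PassiveCtx (right P C) = Passive P × PassiveCtx C

  passive-plug : ∀ C {x} → PassiveCtx C → Passive x → Passive (plug C x)
  passive-plug □           _          px = px
  passive-plug (left C P)  (pC , pP)  px = both (passive-plug C pC px) pP
  passive-plug (right P C) (pP , pC)  px = both pP (passive-plug C pC px)

  data Spawn : Label → Term → Set where
    spawn : ∀ {i I} C → instrAt N i ≡ just I → PassiveCtx C →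
            Spawn (act (inp (nP i))) (plug C (body i I))

  passive-step : ∀ {P ℓ P'} → Passive P → P —[ ℓ ]→ P' → Spawn ℓ P'
  passive-step dead (sumAct ())
  passive-step (instruction h) repAct = spawn (left □ _) h (tt , instruction h)
  passive-step (both p q) (parL d) with passive-step p d
  ... | spawn C h pC = spawn (left C _) h (pC , q)
  passive-step (both p q) (parR d) with passive-step q d
  ... | spawn C h pC = spawn (right _ C) h (p , pC)
  passive-step (both p q) (syncL d₁ d₂) with passive-step q d₂
  ... | ()
  passive-step (both p q) (syncR d₁ d₂) with passive-step p d₁
  ... | ()
  passive-step (both p q) (updL d₁ d₂) with passive-step p d₁
  ... | ()
  passive-step (both p q) (updR d₁ d₂) with passive-step p d₁
  ... | ()

  data CtxStep (C : Ctx) (x : Term) : Label → Term → Set where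
    hole-moves : ∀ {ℓ x'} → x —[ ℓ ]→ x' → CtxStep C x ℓ (plug C x')
    ctx-spawns : ∀ {i t'} → CtxStep C x (act (inp (nP i))) t'
    hole-calls : ∀ {i I x'} C' → x —[ act (out (nP i)) ]→ x' → instrAt N i ≡ just I →
                 PassiveCtx C' → CtxStep C x τ (plug C' (body i I))

  ctx-step : ∀ C {x ℓ t'} → PassiveCtx C → (∀ {a Q x'} → ¬ (x —[ lc a Q ]→ x')) →
             (∀ {a x'} → x —[ act (out a) ]→ x' → Passive x') →
             plug C x —[ ℓ ]→ t' → CtxStep C x ℓ t'
  ctx-step □ _ _ _ d = hole-moves d
  ctx-step (left C P) (pC , pP) noLoc outs (parL d) with ctx-step C pC noLoc outs d
  ... | hole-moves dx          = hole-moves dx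
  ... | ctx-spawns             = ctx-spawns
  ... | hole-calls C' dx h pC' = hole-calls (left C' P) dx h (pC' , pP)
  ctx-step (left C P) (pC , pP) noLoc outs (parR d) with passive-step pP d
  ... | spawn _ _ _ = ctx-spawns
  ctx-step (left C P) (pC , pP) noLoc outs (syncL d₁ d₂) with passive-step pP d₂
  ... | ()
  ctx-step (left C P) (pC , pP) noLoc outs (syncR d₁ d₂)
    with passive-step pP d₂ | ctx-step C pC noLoc outs d₁
  ... | spawn C' h pC' | hole-moves dx =
    hole-calls (right _ C') dx h (passive-plug C pC (outs dx) , pC')
  ctx-step (left C P) (pC , pP) noLoc outs (updL d₁ d₂) with ctx-step C pC noLoc outs d₁
  ... | hole-moves dx = ⊥-elim (noLoc dx)
  ctx-step (left C P) (pC , pP) noLoc outs (updR d₁ d₂) with passive-step pP d₂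
  ... | ()
  ctx-step (right P C) (pP , pC) noLoc outs (parR d) with ctx-step C pC noLoc outs d
  ... | hole-moves dx          = hole-moves dx
  ... | ctx-spawns             = ctx-spawns
  ... | hole-calls C' dx h pC' = hole-calls (right P C') dx h (pP , pC')
  ctx-step (right P C) (pP , pC) noLoc outs (parL d) with passive-step pP d
  ... | spawn _ _ _ = ctx-spawns
  ctx-step (right P C) (pP , pC) noLoc outs (syncR d₁ d₂) with passive-step pP d₁
  ... | ()
  ctx-step (right P C) (pP , pC) noLoc outs (syncL d₁ d₂)
    with passive-step pP d₁ | ctx-step C pC noLoc outs d₂
  ... | spawn C' h pC' | hole-moves dx =
    hole-calls (left C' _) dx h (pC' , passive-plug C pC (outs dx))
  ctx-step (right P C) (pP , pC) noLoc outs (updR d₁ d₂) with ctx-step C pC noLoc outs d₂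
  ... | hole-moves dx = ⊥-elim (noLoc dx)
  ctx-step (right P C) (pP , pC) noLoc outs (updL d₁ d₂) with passive-step pP d₁
  ... | ()

  token-step : ∀ C t {ℓ t'} → PassiveCtx C → plug C ⟦ t ⟧ —[ ℓ ]→ t' → CtxStep C ⟦ t ⟧ ℓ t'
  token-step C t pC = ctx-step C pC (token-noLoc t) outputs-dead
    where
      outputs-dead : ∀ {a x'} → ⟦ t ⟧ —[ act (out a) ]→ x' → Passive x'
      outputs-dead d with move t d
      ... | jumpOut  = dead
      ... | haltLoop = dead

  data Phase (c : Config) : Token → Regs → Set where
    jumping   : Phase c (jump (pcOf c)) (encRegs c)
    executing : ∀ {I} → instrAt N (pcOf c) ≡ just I → Phase c (exec (pcOf c) I) (encRegs c)
    resetting : ∀ {j s} → instrAt N (pcOf c) ≡ just (DECJ j s) → reg j c ≡ 0 →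
                Phase c (reset j s) (encRegs c [ j ≔ emptyReg j ])

  phase-registers : ∀ {c t R} → Phase c t R → ∀ k → Register k (R at k)
  phase-registers {c} jumping            = encRegs-registers c
  phase-registers {c} (executing _)      = encRegs-registers c
  phase-registers {c} (resetting {j} _ _) = emptied-registers j c

  jumping-after : ∀ j pc v c → Phase (setReg j pc v c) (jump pc) (encRegs c [ j ≔ encReg j v ])
  jumping-after j pc v c =
    subst₂ (λ i R → Phase (setReg j pc v c) (jump i) R)
           (pcOf-setReg j pc v c) (encRegs-setReg j pc v c) jumping

  data Successor (c : Config) (R : Regs) : Term → Set where
    successor : ∀ {c' t} → Star (Step N) c c' → Phase c' t R → Successor c R ⟦ t ⟧

  call-step : ∀ {c t R i I x'} → Phase c t R → Move t (act (out (nP i))) x' →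
              instrAt N i ≡ just I → Phase c (exec i I) R
  call-step jumping       jumpOut  h = executing h
  call-step (executing _) haltLoop h = executing h
  call-step (resetting _ _) ()

  input-step : ∀ {c t R k a A' x'} → Phase c t R → R at k —[ act (out a) ]→ A' →
               Move t (act (inp a)) x' → Successor c (R [ k ≔ A' ]) x'
  input-step jumping _ ()
  input-step (resetting _ _) _ ()
  input-step {c} {k = k} (executing h) d decPos
    with register-output k (reg k c) (step-≡ (encRegs-at k c) d)
  ... | zeroTest e _ _ = ⊥-elim (nU≢nZ _ _ e)
  ... | decrement e r refl with nU-injective e
  ...   | refl = successor (decS h r ◅ ε) (jumping-after k (suc (pcOf c)) _ c)
  input-step {c} {k = k} (executing h) d decZero
    with register-output k (reg k c) (step-≡ (encRegs-at k c) d)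
  ... | decrement e _ _ = ⊥-elim (nU≢nZ _ _ (sym e))
  ... | zeroTest e z refl with nZ-injective e
  ...   | refl = successor ε (resetting h z)
  input-step {c} {k = k} (executing h) d haltBarb
    with register-output k (reg k c) (step-≡ (encRegs-at k c) d)
  ... | decrement () _ _
  ... | zeroTest () _ _

  update-step : ∀ {c t R k a Q U A' x'} → Phase c t R → R at k —[ lc a Q ]→ A' →
                Move t (act (upd a U)) x' → Successor c (R [ k ≔ substStar A' (fill U Q) ]) x'
  update-step jumping _ ()
  update-step {c} {k = k} (executing h) d incUpd
    with location-taken (numeral-noLoc k (reg k c)) (step-≡ (encRegs-at k c) d)
  ... | e , refl , refl with nR-injective e
  ...   | refl = successor (inc h ◅ ε) (jumping-after k (suc (pcOf c)) (suc (reg k c)) c)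
  update-step {c} {k = k} (resetting {j} {s} h z) d resetUpd
    with nR-injective (register-name (emptied-registers j c k) d)
  ... | refl with location-taken sum-noLoc (step-≡ (at-set (encRegs c) j (emptyReg j)) d)
  ...   | _ , refl , refl =
    subst (λ R → Successor c R ⟦ jump s ⟧) (sym (set-set (encRegs c) j (emptyReg j) (encReg j 0)))
          (successor (decZ h z ◅ ε) (jumping-after j s 0 c))

  data Good : Term → Set where
    good : ∀ {c C t R} → Reachable c → PassiveCtx C → Phase c t R → Good (sys R (plug C ⟦ t ⟧))

  resume : ∀ {c C R x} → Reachable c → PassiveCtx C → Successor c R x → Good (sys R (plug C x))
  resume r pC (successor s ph) = good (r ◅◅ s) pC ph

  good-sys : ∀ {c C t R T'} → Reachable c → PassiveCtx C → Phase c t R →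
             SysStep R (plug C ⟦ t ⟧) τ T' → Good T'
  good-sys {C = C} {t} r pC ph (inner dX) with token-step C t pC dX
  ... | hole-moves dx with move t dx
  ...   | ()
  good-sys {C = C} {t} r pC ph (inner dX) | hole-calls C' dx h pC' =
    good r pC' (call-step ph (move t dx) h)
  good-sys {C = C} {t} r pC ph (comm k dA dX) with token-step C t pC dX
  ... | hole-moves dx = resume r pC (input-step {k = k} ph dA (move t dx))
  ... | ctx-spawns    = ⊥-elim (register-no-jump (phase-registers ph k) dA)
  good-sys {C = C} {t} r pC ph (update k dA dX) with token-step C t pC dX
  ... | hole-moves dx = resume r pC (update-step {k = k} ph dA (move t dx))

  good-step : ∀ {T T'} → Good T → T ⟶ T' → Good T'
  good-step (good r pC ph) d = good-sys r pC ph (sys-inv (phase-registers ph) (λ ()) d)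

  good-reduces : ∀ {T T'} → Good T → T ⟶* T' → Good T'
  good-reduces g ε        = g
  good-reduces g (d ◅ ds) = good-reduces (good-step g d) ds

  -- Only the body of a HALT instruction offers e.
  good-barb : ∀ {T} → Good T → Barb T (inp nE) →
              Σ Config λ c → Reachable c × instrAt N (pcOf c) ≡ just HALT
  good-barb (good {c} {C} {t} r pC ph) (_ , d)
    with sys-inv (phase-registers ph) (λ ()) d
  ... | inner dX with token-step C t pC dX
  ...   | hole-moves dx = c , r , halting ph (move t dx)
    where
      halting : ∀ {t R x'} → Phase c t R → Move t (act (inp nE)) x' → instrAt N (pcOf c) ≡ just HALT
      halting (executing h) haltBarb = h
      halting (resetting _ _) ()

  passive-instr : ∀ i I → instrAt N i ≡ just I → Passive (encInstr i I)
  passive-instr i (INC j)    h = instruction h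
  passive-instr i (DECJ j s) h = instruction h
  passive-instr i HALT       h = instruction h

  passive-instrs : ∀ k Is →
                   (∀ {m I} → instrAt Is (suc m) ≡ just I → instrAt N (k + m) ≡ just I) →
                   Passive (encInstrs k Is)
  passive-instrs k []       _     = dead
  passive-instrs k (I ∷ Is) agree =
    both (passive-instr k I
           (subst (λ i → instrAt N i ≡ just I) (+-identityʳ k) (agree {0} refl)))
         (passive-instrs (suc k) Is
           (λ {m} {I'} e → subst (λ i → instrAt N i ≡ just I') (+-suc k m) (agree {suc m} e)))

  good-initial : Good (encode N)
  good-initial =
    good {C = right (encInstrs 1 N) □} {t = jump 1} ε (passive-instrs 1 N (λ e → e) , tt) jumping

  -- Backward direction: a single e-barb already forces termination.
  barb→terminates : ∀ {k} → WeakBarb k (inp nE) (encode N) → Terminates N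
  barb→terminates (Q , path , run) = good-barb (good-reduces good-initial path) (first-barb run)
    where
      first-barb : ∀ {k Q} → Run (inp nE) k Q → Barb Q (inp nE)
      first-barb (one b)      = b
      first-barb (more b _ _) = b

  Complete : Ctx → Set
  Complete C = ∀ {i I} → instrAt N i ≡ just I → CtxContains i I C

  -- The encoding holds a replica of every instruction (there is no label 0).
  complete-initial : Complete (right (encInstrs 1 N) □)
  complete-initial {zero}  h = ⊥-elim (no-label-0 N h)
    where
      no-label-0 : ∀ P {I} → instrAt P 0 ≢ just I
      no-label-0 []      ()
      no-label-0 (_ ∷ _) ()
  complete-initial {suc m} h = atR (contains-instrs 1 N h)

  data Ready (c : Config) : Term → Set where
    ready : ∀ {C} → Complete C → Ready c (sys (encRegs c) (plug C (goto (pcOf c))))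

  ready-after : ∀ j pc v c {C} → Complete C →
                Ready (setReg j pc v c) (sys (encRegs c [ j ≔ encReg j v ]) (plug C (goto pc)))
  ready-after j pc v c {C} comp =
    subst₂ (λ R i → Ready (setReg j pc v c) (sys R (plug C (goto i))))
           (encRegs-setReg j pc v c) (pcOf-setReg j pc v c) (ready comp)

  -- Each machine step is matched by two or three reductions: the jump calls the
  -- instruction, whose body then interacts with the register.
  simulate : ∀ {c c' T} → Ready c T → Step N c c' → Σ Term λ T' → T ⟶* T' × Ready c' T'
  simulate {c} (ready {C} comp) (inc {j = j} h) with call C summand₁ (comp h)
  ... | C' , d , keep =
    _ , sys-step (inner d) ◅ sys-step (update j (register-at j c locOut) (plug-step C' summand₁)) ◅ ε ,
    ready-after j (suc (pcOf c)) (suc (reg j c)) c (λ h' → keep (comp h'))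
  simulate {c} (ready {C} comp) (decS {j = j} {m = m} h e) with call C summand₁ (comp h)
  ... | C' , d , keep =
    _ , sys-step (inner d) ◅ sys-step (comm j (decrement-at j c e) (plug-step C' summand₁)) ◅ ε ,
    ready-after j (suc (pcOf c)) m c (λ h' → keep (comp h'))
  simulate {c} (ready {C} comp) (decZ {j = j} {s = s} h z) with call C summand₁ (comp h)
  ... | C' , d , keep =
    _ , sys-step (inner d) ◅ sys-step (comm j (zero-at j c z) (plug-step C' summand₂))
          ◅ sys-step (update j emptied (plug-step C' summand₁)) ◅ ε ,
    subst (λ R → Ready (setReg j s 0 c) (sys R (plug C' (goto s))))
          (sym (set-set (encRegs c) j (emptyReg j) (encReg j 0)))
          (ready-after j s 0 c (λ h' → keep (comp h')))
    where
      emptied : (encRegs c [ j ≔ emptyReg j ]) at j —[ lc (nR j) nil ]→ star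
      emptied = step-≡ (sym (at-set (encRegs c) j (emptyReg j))) locOut

  simulate* : ∀ {c c' T} → Ready c T → Star (Step N) c c' → Σ Term λ T' → T ⟶* T' × Ready c' T'
  simulate* rd ε = _ , ε , rd
  simulate* rd (s ◅ ss) with simulate rd s
  ... | _ , p₁ , rd₁ with simulate* rd₁ ss
  ...   | T₂ , p₂ , rd₂ = T₂ , p₁ ◅◅ p₂ , rd₂

  halting-run : ∀ k {i C R} → Complete C → instrAt N i ≡ just HALT →
                Run (inp nE) (suc k) (sys R (plug C (body i HALT)))
  halting-run zero    {C = C} _ _ = one (_ , sys-step (inner (plug-step C summand₁)))
  halting-run (suc k) {C = C} comp h with call C summand₂ (comp h)
  ... | C' , d , keep =
    more (_ , sys-step (inner (plug-step C summand₁))) (sys-step (inner d))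
         (halting-run k (λ h' → keep (comp h')) h)

  terminates→barb : ∀ k → Terminates N → WeakBarb (suc k) (inp nE) (encode N)
  terminates→barb k (c , run , halt)
    with simulate* (ready {C = right (encInstrs 1 N) □} complete-initial) run
  ... | _ , path , ready {C} comp with call C summand₁ (comp halt)
  ...   | C' , d , keep =
    _ , path ◅◅ (sys-step (inner d) ◅ ε) , halting-run k (λ h' → keep (comp h')) halt

lemma6p2 : (N : Program) → WellFormed N → (k : ℕ) → 1 ≤ k →
           Terminates N ⇔ WeakBarb k (inp nE) (encode N)
lemma6p2 N _ (suc k) (s≤s z≤n) = mk⇔ (terminates→barb k) barb→terminates
  where open Simulation N
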